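{- Let $s,r$ be integers with $0<s<r$, let $\mathbf{S}=s\text{ -IN- }r\text{ -SAT}$ and $\mathbf{T}=r\text{ -NAE-SAT}$. Then $(\mathbf{S},\mathbf{T})$ has SA-width $2$; that is, for every structure $\mathbf{I}$ (with one $r$-ary relation), if the linear program $\mathrm{SA}^2(\mathbf{I},\mathbf{S})$ is feasible then there is a homomorphism $\mathbf{I}\to\mathbf{T}$.
   Context: $s\text{ -IN- }r\text{ -SAT}$ is the structure with domain $\{0,1\}$ and a single $r$-ary relation $R$ consisting of all tuples in $\{0,1\}^r$ with exactly $s$ ones; $r\text{ -NAE-SAT}$ has domain $\{0,1\}$ and single $r$-ary relation consisting of all tuples in $\{0,1\}^r$ except the two constant tuples. Sherali–Adams relaxation: let $\mathbf{I}$ have domain $I$ and $\mathbf{S}$ have domain $S=[p]$ (identify $\{0,1\}$ with $[2]$). For each relation symbol $R$ of arity $r$, let $Z_R\subseteq\{0,1\}^{rp}$ be the set of characteristic vectors $v_{\mathbf{t}}$ of tuples $\mathbf{t}\in R^{\mathbf{S}}$ (with $v_{\mathbf{t},i,j}=1$ iff $\mathbf{t}(i)=j$), and let $A_Rx\le b_R$ be a linear-inequality description of the convex hull of $Z_R$. Let $M_k(I,S)$ be the set of maps from a subset of $I$ of size at most $k$ into $S$. $\mathrm{SA}^k(\mathbf{I},\mathbf{S})$ has a variable $x_f$ for each $f\in M_k(I,S)$ and constraints: $x_\emptyset=1$; $\sum_{a\in[p]}x_{f\cup\{u\mapsto a\}}=x_f$ for all $f\in M_{k-1}(I,S)$ and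 $u\in I\setminus\mathrm{dom}(f)$; $A_R x_{f,\mathbf{u}}\le b_R x_f$ for all $f\in M_{k-1}(I,S)$, $R$, and $\mathbf{u}=(u_1,\dots,u_r)\in R^{\mathbf{I}}$, where $x_{f,\mathbf{u}}=(x_{f\cup\{u_1\mapsto1\}},\dots,x_{f\cup\{u_1\mapsto p\}},\dots,x_{f\cup\{u_r\mapsto 1\}},\dots,x_{f\cup\{u_r\mapsto p\}})$; and $0\le x_f\le1$ for all $f\in M_k(I,S)$. A template $(\mathbf{S},\mathbf{T})$ (with $\mathbf{S}\to\mathbf{T}$) has SA-width $k(n)$ if for every instance $\mathbf{I}$ with $n$ elements, feasibility of $\mathrm{SA}^{k(n)}(\mathbf{I},\mathbf{S})$ implies $\mathbf{I}\to\mathbf{T}$.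
   Formalization: The Sherali–Adams variables $x_f$ take rational values, and the descriptions $A_Rx\le b_R$ of the convex hull of $Z_R$ have rational coefficients. -}

module Defs where

open import Data.Nat using (ℕ; zero; suc) renaming (_+_ to _+ℕ_)
open import Data.Fin using (Fin; zero; suc; toℕ; _≟_)
open import Data.Maybe using (Maybe; just; nothing)
open import Data.Vec using (Vec; []; _∷_; lookup; replicate; _[_]≔_)
open import Data.List using (List; []; _∷_)
open import Data.Product using (Σ; _×_; _,_; ∃)
open import Data.Rational using (ℚ; 0ℚ; 1ℚ; _+_; _*_; _≤_)
open import Relation.Nullary using (¬_; yes; no)
open import Relation.Binary.PropositionalEquality using (_≡_)
open import Function.Bundles using (_⇔_)

𝟘 𝟙 : Fin 2
𝟘 = zero
𝟙 = suc zero

∑ : (k : ℕ) → (Fin k → ℚ) → ℚ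
∑ zero    f = 0ℚ
∑ (suc k) f = f zero + ∑ k (λ i → f (suc i))

∑ℕ : (k : ℕ) → (Fin k → ℕ) → ℕ
∑ℕ zero    f = 0
∑ℕ (suc k) f = f zero +ℕ ∑ℕ k (λ i → f (suc i))

InSat : (s r : ℕ) → (Fin r → Fin 2) → Set
InSat s r t = ∑ℕ r (λ l → toℕ (t l)) ≡ s

NAE : (r : ℕ) → (Fin r → Fin 2) → Set
NAE r t = ¬ (∀ l → t l ≡ 𝟘) × ¬ (∀ l → t l ≡ 𝟙)

HomToNAE : (n r : ℕ) → ((Fin r → Fin n) → Set) → Set
HomToNAE n r RI = Σ (Fin n → Fin 2) λ h → ∀ u → RI u → NAE r (λ l → h (u l))

χ : {r : ℕ} → (Fin r → Fin 2) → Fin r → Fin 2 → ℚ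
χ t l j with t l ≟ j
... | yes _ = 1ℚ
... | no  _ = 0ℚ

-- Vectors in ℚ^{r·2}, coordinates indexed by (l , j) ∈ Fin r × Fin 2.
-- Convex hull of Z_R (R = s-IN-r-SAT): y is a finite convex combination of
-- characteristic vectors of tuples of R.
WeightedTuples : ℕ → Set
WeightedTuples r = List (ℚ × (Fin r → Fin 2))

totalWeight : {r : ℕ} → WeightedTuples r → ℚ
totalWeight []             = 0ℚ
totalWeight ((λ' , _) ∷ w) = λ' + totalWeight w

combo : {r : ℕ} → WeightedTuples r → Fin r → Fin 2 → ℚ
combo []             l j = 0ℚ
combo ((λ' , t) ∷ w) l j = λ' * χ t l j + combo w l j

data AllOK (s r : ℕ) : WeightedTuples r → Set where
  []  : AllOK s r []
  _∷_ : ∀ {λ' t w} → (0ℚ ≤ λ' × InSat s r t) → AllOK s r w → AllOK s r ((λ' , t) ∷ w)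

InConvHull : (s r : ℕ) → (Fin r → Fin 2 → ℚ) → Set
InConvHull s r y = Σ (WeightedTuples r) λ w →
  AllOK s r w × totalWeight w ≡ 1ℚ × (∀ l j → y l j ≡ combo w l j)

Row : ℕ → Set
Row r = Fin r → Fin 2 → ℚ

dot : {r : ℕ} → Row r → (Fin r → Fin 2 → ℚ) → ℚ
dot {r} a y = ∑ r (λ l → ∑ 2 (λ j → a l j * y l j))

Describes : (s r m : ℕ) → (Fin m → Row r) → (Fin m → ℚ) → Set
Describes s r m A b = ∀ (y : Fin r → Fin 2 → ℚ) →
  (∀ i → dot (A i) y ≤ b i) ⇔ InConvHull s r y

PMap : ℕ → Set
PMap n = Vec (Maybe (Fin 2)) n

size : {n : ℕ} → PMap n → ℕ
size []             = 0
size (nothing ∷ f) = size f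
size (just _ ∷ f)  = suc (size f)

data _≤ℕ_ : ℕ → ℕ → Set where
  z≤ : ∀ {n} → zero ≤ℕ n
  s≤ : ∀ {m n} → m ≤ℕ n → suc m ≤ℕ suc n

-- Value of the variable x_{f ∪ {u ↦ j}}; if u ∈ dom f this is x_f when
-- f(u) = j and 0 when the union is not a function.
xExt : {n : ℕ} → (PMap n → ℚ) → PMap n → Fin n → Fin 2 → ℚ
xExt x f u j with lookup f u
... | nothing = x (f [ u ]≔ just j)
... | just a with a ≟ j
...   | yes _ = x f
...   | no  _ = 0ℚ

SAFeasible : (k s r n m : ℕ) → ((Fin r → Fin n) → Set) →
             (Fin m → Row r) → (Fin m → ℚ) → Set
SAFeasible k s r n m RI A b = Σ (PMap n → ℚ) λ x →
    (x (replicate n nothing) ≡ 1ℚ)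
  × (∀ (f : PMap n) → suc (size f) ≤ℕ k → ∀ u → lookup f u ≡ nothing →
       x (f [ u ]≔ just 𝟘) + x (f [ u ]≔ just 𝟙) ≡ x f)
  × (∀ (f : PMap n) → suc (size f) ≤ℕ k → ∀ (u : Fin r → Fin n) → RI u →
       ∀ i → dot (A i) (λ l j → xExt x f (u l) j) ≤ b i * x f)
  × (∀ (f : PMap n) → size f ≤ℕ k → (0ℚ ≤ x f) × (x f ≤ 1ℚ))

{-# OPTIONS --safe #-}
-- Give every variable v the profile vector in ℚ^(1+n) with coordinate 0 equal to
-- r·x(v↦1) − s and coordinate w+1 equal to r·x(w↦1, v↦1) − s·x(w↦1) (or 0 when
-- x(w↦1) = 0). Since x_{f,u}/x_f lies in the convex hull of the tuples with exactly
-- s ones, the profiles of the r entries of any constraint sum to zero coordinatewise.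
-- No profile vanishes: if x(v↦1) = 0 coordinate 0 is −s, and otherwise coordinate v+1
-- is (r − s)·x(v↦1) > 0. So every constraint contains a lexicographically positive
-- profile and one that is not, and setting v to 1 exactly when its profile is
-- lexicographically positive satisfies every constraint of r-NAE-SAT.
module Submission where

open import Defs
open import Data.Nat using (ℕ; zero; suc; _<_; s<s) renaming (_+_ to _+ℕ_)
open import Data.Fin using (Fin; zero; suc; toℕ)
import Data.Fin as Fin
open import Data.Fin.Properties using (any?; all?; ¬∀⟶∃¬)
open import Data.Maybe using (just; nothing)
open import Data.Vec using (_∷_; lookup; replicate; _[_]≔_)
open import Data.Vec.Properties using (lookup-replicate; lookup∘update)
open import Data.Bool using (Bool; true; false; if_then_else_)
open import Data.List using ([]; _∷_)
open import Data.Product using (_×_; _,_; ∃; proj₁)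
open import Data.Rational using (ℚ; 0ℚ; 1ℚ; _+_; _*_; _-_; -_; _≤_; 1/_; _≟_; _<?_;
  Positive; NonNegative; NonZero; positive; nonNegative) renaming (_<_ to _<ℚ_)
open import Data.Rational.Properties
open import Data.Rational.Solver using (module +-*-Solver)
open import Data.Empty using (⊥-elim)
open import Function using (_∘_)
open import Function.Bundles using (Equivalence)
open import Relation.Binary.Definitions using (tri<; tri≈; tri>)
open import Relation.Binary.PropositionalEquality
open import Relation.Nullary using (¬_; Dec; yes; no)
open +-*-Solver using (solve; _:=_; _:+_; _:*_; _:-_; :-_; con)

fromℕ : ℕ → ℚ
fromℕ zero    = 0ℚ
fromℕ (suc k) = 1ℚ + fromℕ k

fromℕ-+ : ∀ a b → fromℕ (a +ℕ b) ≡ fromℕ a + fromℕ b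
fromℕ-+ zero    b = sym (+-identityˡ (fromℕ b))
fromℕ-+ (suc a) b = trans (cong (1ℚ +_) (fromℕ-+ a b)) (sym (+-assoc 1ℚ (fromℕ a) (fromℕ b)))

0≤fromℕ : ∀ a → 0ℚ ≤ fromℕ a
0≤fromℕ zero    = ≤-refl
0≤fromℕ (suc a) = +-mono-≤ (<⇒≤ (positive⁻¹ 1ℚ)) (0≤fromℕ a)

0<fromℕ-suc : ∀ a → 0ℚ <ℚ fromℕ (suc a)
0<fromℕ-suc a = +-mono-<-≤ (positive⁻¹ 1ℚ) (0≤fromℕ a)

fromℕ-<⇒0<- : ∀ {a b} → a < b → 0ℚ <ℚ fromℕ b - fromℕ a
fromℕ-<⇒0<- {zero}  {suc b} _         = subst (0ℚ <ℚ_) (sym (+-identityʳ _)) (0<fromℕ-suc b)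
fromℕ-<⇒0<- {suc a} {suc b} (s<s a<b) = subst (0ℚ <ℚ_) shift (fromℕ-<⇒0<- a<b)
  where
  shift : fromℕ b - fromℕ a ≡ fromℕ (suc b) - fromℕ (suc a)
  shift = solve 2 (λ a b → b :- a := (con 1ℚ :+ b) :- (con 1ℚ :+ a)) refl (fromℕ a) (fromℕ b)

∑-cong : ∀ k {f g : Fin k → ℚ} → (∀ i → f i ≡ g i) → ∑ k f ≡ ∑ k g
∑-cong zero    f≡g = refl
∑-cong (suc k) f≡g = cong₂ _+_ (f≡g zero) (∑-cong k (f≡g ∘ suc))

∑-+ : ∀ k (f g : Fin k → ℚ) → ∑ k (λ i → f i + g i) ≡ ∑ k f + ∑ k g
∑-+ zero    f g = refl
∑-+ (suc k) f g = trans (cong (f zero + g zero +_) (∑-+ k (f ∘ suc) (g ∘ suc)))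
  (solve 4 (λ a b c d → (a :+ b) :+ (c :+ d) := (a :+ c) :+ (b :+ d)) refl
    (f zero) (g zero) (∑ k (f ∘ suc)) (∑ k (g ∘ suc)))

∑-* : ∀ k c (f : Fin k → ℚ) → ∑ k (λ i → c * f i) ≡ c * ∑ k f
∑-* zero    c f = sym (*-zeroʳ c)
∑-* (suc k) c f = trans (cong (c * f zero +_) (∑-* k c (f ∘ suc))) (sym (*-distribˡ-+ c (f zero) _))

∑-const : ∀ k c → ∑ k (λ _ → c) ≡ fromℕ k * c
∑-const zero    c = sym (*-zeroˡ c)
∑-const (suc k) c = trans (cong (c +_) (∑-const k c))
  (solve 2 (λ c x → c :+ x :* c := (con 1ℚ :+ x) :* c) refl c (fromℕ k))

∑-zero : ∀ k → ∑ k (λ _ → 0ℚ) ≡ 0ℚ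
∑-zero k = trans (∑-const k 0ℚ) (*-zeroʳ (fromℕ k))

fromℕ-∑ℕ : ∀ k (f : Fin k → ℕ) → ∑ k (fromℕ ∘ f) ≡ fromℕ (∑ℕ k f)
fromℕ-∑ℕ zero    f = refl
fromℕ-∑ℕ (suc k) f = trans (cong (fromℕ (f zero) +_) (fromℕ-∑ℕ k (f ∘ suc))) (sym (fromℕ-+ (f zero) _))

∑-mono-≤ : ∀ k {f g : Fin k → ℚ} → (∀ i → f i ≤ g i) → ∑ k f ≤ ∑ k g
∑-mono-≤ zero    f≤g = ≤-refl
∑-mono-≤ (suc k) f≤g = +-mono-≤ (f≤g zero) (∑-mono-≤ k (f≤g ∘ suc))

∑-mono-< : ∀ k {f g : Fin k → ℚ} → (∀ i → f i ≤ g i) → ∀ i → f i <ℚ g i → ∑ k f <ℚ ∑ k g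
∑-mono-< (suc k) f≤g zero    fi<gi = +-mono-<-≤ fi<gi (∑-mono-≤ k (f≤g ∘ suc))
∑-mono-< (suc k) f≤g (suc i) fi<gi = +-mono-≤-< (f≤g zero) (∑-mono-< k (f≤g ∘ suc) i fi<gi)

∑≡0⇒∃-pos : ∀ k {g : Fin k → ℚ} → ∑ k g ≡ 0ℚ → ∀ i → g i <ℚ 0ℚ → ∃ λ j → 0ℚ <ℚ g j
∑≡0⇒∃-pos k {g} ∑g≡0 i gi<0 with any? (λ j → 0ℚ <? g j)
... | yes pos = pos
... | no ¬pos = ⊥-elim (<-irrefl (trans ∑g≡0 (sym (∑-zero k)))
                         (∑-mono-< k (λ j → ≮⇒≥ (¬pos ∘ (j ,_))) i gi<0))

∑≡0⇒∃-neg : ∀ k {g : Fin k → ℚ} → ∑ k g ≡ 0ℚ → ∀ i → 0ℚ <ℚ g i → ∃ λ j → g j <ℚ 0ℚ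
∑≡0⇒∃-neg k {g} ∑g≡0 i 0<gi with any? (λ j → g j <? 0ℚ)
... | yes neg = neg
... | no ¬neg = ⊥-elim (<-irrefl (trans (∑-zero k) (sym ∑g≡0))
                         (∑-mono-< k (λ j → ≮⇒≥ (¬neg ∘ (j ,_))) i 0<gi))

∑≡0⇒∃-pos×∃-neg : ∀ k {g : Fin k → ℚ} → ∑ k g ≡ 0ℚ → ∀ i → ¬ g i ≡ 0ℚ →
  (∃ λ j → 0ℚ <ℚ g j) × (∃ λ j → g j <ℚ 0ℚ)
∑≡0⇒∃-pos×∃-neg k {g} ∑g≡0 i gi≢0 with <-cmp (g i) 0ℚ
... | tri< gi<0 _ _ = ∑≡0⇒∃-pos k ∑g≡0 i gi<0 , (i , gi<0)
... | tri≈ _ gi≡0 _ = ⊥-elim (gi≢0 gi≡0)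
... | tri> _ _ 0<gi = (i , 0<gi) , ∑≡0⇒∃-neg k ∑g≡0 i 0<gi

lexPositive : ∀ {d} → (Fin d → ℚ) → Bool
lexPositive {zero}  v = false
lexPositive {suc d} v with <-cmp 0ℚ (v zero)
... | tri< _ _ _ = true
... | tri≈ _ _ _ = lexPositive (v ∘ suc)
... | tri> _ _ _ = false

lexPositive-head-pos : ∀ {d} (v : Fin (suc d) → ℚ) → 0ℚ <ℚ v zero → lexPositive v ≡ true
lexPositive-head-pos v 0<v₀ with <-cmp 0ℚ (v zero)
... | tri< _ _ _   = refl
... | tri≈ ¬< _ _  = ⊥-elim (¬< 0<v₀)
... | tri> ¬< _ _  = ⊥-elim (¬< 0<v₀)

lexPositive-head-neg : ∀ {d} (v : Fin (suc d) → ℚ) → v zero <ℚ 0ℚ → lexPositive v ≡ false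
lexPositive-head-neg v v₀<0 with <-cmp 0ℚ (v zero)
... | tri< _ _ ¬>  = ⊥-elim (¬> v₀<0)
... | tri≈ _ _ ¬>  = ⊥-elim (¬> v₀<0)
... | tri> _ _ _   = refl

lexPositive-head-zero : ∀ {d} (v : Fin (suc d) → ℚ) → v zero ≡ 0ℚ → lexPositive v ≡ lexPositive (v ∘ suc)
lexPositive-head-zero v v₀≡0 with <-cmp 0ℚ (v zero)
... | tri< _ ¬≡ _  = ⊥-elim (¬≡ (sym v₀≡0))
... | tri≈ _ _ _   = refl
... | tri> _ ¬≡ _  = ⊥-elim (¬≡ (sym v₀≡0))

lexPositive-split : ∀ k d (W : Fin k → Fin d → ℚ) → (∀ c → ∑ k (λ l → W l c) ≡ 0ℚ) →
  ∀ l c → ¬ W l c ≡ 0ℚ →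
  (∃ λ l⁺ → lexPositive (W l⁺) ≡ true) × (∃ λ l⁻ → lexPositive (W l⁻) ≡ false)
lexPositive-split k (suc d) W ∑≡0 l c Wlc≢0 with all? (λ l → W l zero ≟ 0ℚ)
... | no ¬allZero with ¬∀⟶∃¬ k _ (λ l → W l zero ≟ 0ℚ) ¬allZero
...   | l₀ , Wl₀≢0 with ∑≡0⇒∃-pos×∃-neg k (∑≡0 zero) l₀ Wl₀≢0
...     | (l⁺ , pos) , (l⁻ , neg) =
  (l⁺ , lexPositive-head-pos (W l⁺) pos) , (l⁻ , lexPositive-head-neg (W l⁻) neg)
lexPositive-split k (suc d) W ∑≡0 l zero    Wlc≢0 | yes allZero = ⊥-elim (Wlc≢0 (allZero l))
lexPositive-split k (suc d) W ∑≡0 l (suc c) Wlc≢0 | yes allZero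
  with lexPositive-split k d (λ l → W l ∘ suc) (∑≡0 ∘ suc) l c Wlc≢0
... | (l⁺ , pos) , (l⁻ , neg) =
  (l⁺ , trans (lexPositive-head-zero (W l⁺) (allZero l⁺)) pos) ,
  (l⁻ , trans (lexPositive-head-zero (W l⁻) (allZero l⁻)) neg)

≢𝟙⇒≡𝟘 : ∀ {a : Fin 2} → ¬ a ≡ 𝟙 → a ≡ 𝟘
≢𝟙⇒≡𝟘 {zero}     _  = refl
≢𝟙⇒≡𝟘 {suc zero} a≢𝟙 = ⊥-elim (a≢𝟙 refl)

χ-𝟙 : ∀ {r} (t : Fin r → Fin 2) l → χ t l 𝟙 ≡ fromℕ (toℕ (t l))
χ-𝟙 t l with t l Fin.≟ 𝟙
... | yes tl≡𝟙 = trans (sym (+-identityʳ 1ℚ)) (cong (fromℕ ∘ toℕ) (sym tl≡𝟙))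
... | no  tl≢𝟙 = cong (fromℕ ∘ toℕ) (sym (≢𝟙⇒≡𝟘 tl≢𝟙))

combo-∑𝟙 : ∀ s r (w : WeightedTuples r) → AllOK s r w →
  ∑ r (λ l → combo w l 𝟙) ≡ fromℕ s * totalWeight w
combo-∑𝟙 s r []                ok = trans (∑-zero r) (sym (*-zeroʳ (fromℕ s)))
combo-∑𝟙 s r ((λ' , t) ∷ w) ((_ , ones≡s) ∷ ok) = begin
  ∑ r (λ l → λ' * χ t l 𝟙 + combo w l 𝟙)
    ≡⟨ ∑-+ r _ _ ⟩
  ∑ r (λ l → λ' * χ t l 𝟙) + ∑ r (λ l → combo w l 𝟙)
    ≡⟨ cong₂ _+_ (∑-* r λ' _) (combo-∑𝟙 s r w ok) ⟩
  λ' * ∑ r (λ l → χ t l 𝟙) + fromℕ s * totalWeight w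
    ≡⟨ cong (λ z → λ' * z + fromℕ s * totalWeight w) ∑χ≡s ⟩
  λ' * fromℕ s + fromℕ s * totalWeight w
    ≡⟨ solve 3 (λ a b c → a :* b :+ b :* c := b :* (a :+ c)) refl λ' (fromℕ s) (totalWeight w) ⟩
  fromℕ s * (λ' + totalWeight w) ∎
  where
  open ≡-Reasoning
  ∑χ≡s : ∑ r (λ l → χ t l 𝟙) ≡ fromℕ s
  ∑χ≡s = trans (∑-cong r (χ-𝟙 t)) (trans (fromℕ-∑ℕ r (toℕ ∘ t)) (cong fromℕ ones≡s))

InConvHull⇒∑𝟙≡s : ∀ s r y → InConvHull s r y → ∑ r (λ l → y l 𝟙) ≡ fromℕ s
InConvHull⇒∑𝟙≡s s r y (w , ok , total≡1 , y≡combo) = begin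
  ∑ r (λ l → y l 𝟙)          ≡⟨ ∑-cong r (λ l → y≡combo l 𝟙) ⟩
  ∑ r (λ l → combo w l 𝟙)    ≡⟨ combo-∑𝟙 s r w ok ⟩
  fromℕ s * totalWeight w   ≡⟨ cong (fromℕ s *_) total≡1 ⟩
  fromℕ s * 1ℚ              ≡⟨ *-identityʳ (fromℕ s) ⟩
  fromℕ s                   ∎
  where open ≡-Reasoning

dot-scale : ∀ {r} (a : Row r) c (y : Fin r → Fin 2 → ℚ) → dot a (λ l j → c * y l j) ≡ c * dot a y
dot-scale {r} a c y = begin
  ∑ r (λ l → ∑ 2 (λ j → a l j * (c * y l j)))  ≡⟨ ∑-cong r (λ l → ∑-cong 2 (λ j → swap (a l j) (y l j))) ⟩
  ∑ r (λ l → ∑ 2 (λ j → c * (a l j * y l j)))  ≡⟨ ∑-cong r (λ l → ∑-* 2 c (λ j → a l j * y l j)) ⟩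
  ∑ r (λ l → c * ∑ 2 (λ j → a l j * y l j))    ≡⟨ ∑-* r c _ ⟩
  c * dot a y                                  ∎
  where
  open ≡-Reasoning
  swap : ∀ u v → u * (c * v) ≡ c * (u * v)
  swap u v = solve 3 (λ u v c → u :* (c :* v) := c :* (u :* v)) refl u v c

Describes⇒scaled-InConvHull : ∀ {s r m A b} → Describes s r m A b →
  ∀ (y : Fin r → Fin 2 → ℚ) c d → 0ℚ ≤ d → d * c ≡ 1ℚ → (∀ i → dot (A i) y ≤ b i * c) →
  InConvHull s r (λ l j → d * y l j)
Describes⇒scaled-InConvHull {A = A} {b} desc y c d 0≤d dc≡1 Ay≤bc = Equivalence.to (desc _) Az≤b
  where
  instance
    d-nonNeg : NonNegative d
    d-nonNeg = nonNegative 0≤d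
  Az≤b : ∀ i → dot (A i) (λ l j → d * y l j) ≤ b i
  Az≤b i = begin
    dot (A i) (λ l j → d * y l j)  ≡⟨ dot-scale (A i) d y ⟩
    d * dot (A i) y                ≤⟨ *-monoˡ-≤-nonNeg d (Ay≤bc i) ⟩
    d * (b i * c)                  ≡⟨ solve 3 (λ d u v → d :* (u :* v) := u :* (d :* v)) refl d (b i) c ⟩
    b i * (d * c)                  ≡⟨ cong (b i *_) dc≡1 ⟩
    b i * 1ℚ                       ≡⟨ *-identityʳ (b i) ⟩
    b i                            ∎
    where open ≤-Reasoning

Describes⇒∑𝟙≡ : ∀ {s r m A b} → Describes s r m A b →
  ∀ (y : Fin r → Fin 2 → ℚ) c → 0ℚ <ℚ c → (∀ i → dot (A i) y ≤ b i * c) →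
  ∑ r (λ l → y l 𝟙) ≡ c * fromℕ s
Describes⇒∑𝟙≡ {s} {r} {A = A} {b} desc y c 0<c Ay≤bc = begin
  ∑ r (λ l → y l 𝟙)                ≡⟨ ∑-cong r (λ l → sym (c*[c⁻¹*v]≡v (y l 𝟙))) ⟩
  ∑ r (λ l → c * (1/ c * y l 𝟙))   ≡⟨ ∑-* r c _ ⟩
  c * ∑ r (λ l → 1/ c * y l 𝟙)     ≡⟨ cong (c *_) (InConvHull⇒∑𝟙≡s s r _ scaled) ⟩
  c * fromℕ s                       ∎
  where
  open ≡-Reasoning
  instance
    c-pos : Positive c
    c-pos = positive 0<c
    c-nonZero : NonZero c
    c-nonZero = pos⇒nonZero c
  c*[c⁻¹*v]≡v : ∀ v → c * (1/ c * v) ≡ v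
  c*[c⁻¹*v]≡v v = trans (sym (*-assoc c (1/ c) v)) (trans (cong (_* v) (*-inverseʳ c)) (*-identityˡ v))
  scaled : InConvHull s r (λ l j → 1/ c * y l j)
  scaled = Describes⇒scaled-InConvHull {A = A} {b} desc y c (1/ c)
    (nonNegative⁻¹ (1/ c) {{pos⇒nonNeg (1/ c) {{1/pos⇒pos c}}}}) (*-inverseˡ c) Ay≤bc

size-replicate-nothing : ∀ n → size (replicate n (nothing {A = Fin 2})) ≡ 0
size-replicate-nothing zero    = refl
size-replicate-nothing (suc n) = size-replicate-nothing n

size-insert : ∀ {n} (f : PMap n) u a → lookup f u ≡ nothing → size (f [ u ]≔ just a) ≡ suc (size f)
size-insert (nothing ∷ f) zero    a _  = refl
size-insert (just _ ∷ f)  zero    a ()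
size-insert (nothing ∷ f) (suc u) a fu≡nothing = size-insert f u a fu≡nothing
size-insert (just _ ∷ f)  (suc u) a fu≡nothing = cong suc (size-insert f u a fu≡nothing)

xExt-unassigned : ∀ {n} (x : PMap n → ℚ) f u j → lookup f u ≡ nothing → xExt x f u j ≡ x (f [ u ]≔ just j)
xExt-unassigned x f u j fu≡nothing with lookup f u | fu≡nothing
... | nothing | _ = refl

xExt-assigned : ∀ {n} (x : PMap n → ℚ) f u j → lookup f u ≡ just j → xExt x f u j ≡ x f
xExt-assigned x f u j fu≡j with lookup f u | fu≡j
... | just .j | refl with j Fin.≟ j
...   | yes _   = refl
...   | no j≢j  = ⊥-elim (j≢j refl)

module NAEFromSA {s r n m} {RI : (Fin r → Fin n) → Set} {A : Fin m → Row r} {b : Fin m → ℚ}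
  (desc : Describes s r m A b) (x : PMap n → ℚ)
  (x∅≡1 : x (replicate n nothing) ≡ 1ℚ)
  (Ax≤bx : ∀ f → suc (size f) ≤ℕ 2 → ∀ u → RI u →
           ∀ i → dot (A i) (λ l j → xExt x f (u l) j) ≤ b i * x f)
  (x≥0 : ∀ f → size f ≤ℕ 2 → 0ℚ ≤ x f)
  (0<s : 0ℚ <ℚ fromℕ s) (0<r-s : 0ℚ <ℚ fromℕ r - fromℕ s) where

  ∅ : PMap n
  ∅ = replicate n nothing

  ⟨_↦𝟙⟩ : Fin n → PMap n
  ⟨ w ↦𝟙⟩ = ∅ [ w ]≔ just 𝟙

  size-⟨↦𝟙⟩ : ∀ w → size ⟨ w ↦𝟙⟩ ≡ 1
  size-⟨↦𝟙⟩ w = trans (size-insert ∅ w 𝟙 (lookup-replicate w nothing)) (cong suc (size-replicate-nothing n))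

  condition : Fin (suc n) → PMap n
  condition zero    = ∅
  condition (suc w) = ⟨ w ↦𝟙⟩

  condition-extendable : ∀ c → suc (size (condition c)) ≤ℕ 2
  condition-extendable zero    = subst (λ k → suc k ≤ℕ 2) (sym (size-replicate-nothing n)) (s≤ z≤)
  condition-extendable (suc w) = subst (λ k → suc k ≤ℕ 2) (sym (size-⟨↦𝟙⟩ w)) (s≤ (s≤ z≤))

  0<x∅ : 0ℚ <ℚ x ∅
  0<x∅ = subst (0ℚ <ℚ_) (sym x∅≡1) (positive⁻¹ 1ℚ)

  excess : PMap n → Fin n → ℚ
  excess f v = fromℕ r * xExt x f v 𝟙 - fromℕ s * x f

  ∑-excess≡0 : ∀ f → suc (size f) ≤ℕ 2 → 0ℚ <ℚ x f → ∀ u → RI u → ∑ r (λ l → excess f (u l)) ≡ 0ℚ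
  ∑-excess≡0 f extendable 0<xf u Iu = begin
    ∑ r (λ l → fromℕ r * xExt x f (u l) 𝟙 + - (fromℕ s * x f))
      ≡⟨ ∑-+ r _ _ ⟩
    ∑ r (λ l → fromℕ r * xExt x f (u l) 𝟙) + ∑ r (λ _ → - (fromℕ s * x f))
      ≡⟨ cong₂ _+_ (∑-* r (fromℕ r) _) (∑-const r _) ⟩
    fromℕ r * ∑ r (λ l → xExt x f (u l) 𝟙) + fromℕ r * - (fromℕ s * x f)
      ≡⟨ cong (λ t → fromℕ r * t + fromℕ r * - (fromℕ s * x f))
           (Describes⇒∑𝟙≡ {A = A} {b} desc (λ l j → xExt x f (u l) j) (x f) 0<xf (Ax≤bx f extendable u Iu)) ⟩
    fromℕ r * (x f * fromℕ s) + fromℕ r * - (fromℕ s * x f)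
      ≡⟨ solve 3 (λ a c d → a :* (c :* d) :+ a :* (:- (d :* c)) := con 0ℚ) refl (fromℕ r) (x f) (fromℕ s) ⟩
    0ℚ ∎
    where open ≡-Reasoning

  excessIf : ∀ f → Dec (0ℚ <ℚ x f) → Fin n → ℚ
  excessIf f (yes _) = excess f
  excessIf f (no _)  = λ _ → 0ℚ

  excessIf-pos : ∀ f v (d : Dec (0ℚ <ℚ x f)) → 0ℚ <ℚ x f → excessIf f d v ≡ excess f v
  excessIf-pos f v (yes _)  _    = refl
  excessIf-pos f v (no ¬0<) 0<xf = ⊥-elim (¬0< 0<xf)

  profile : Fin n → Fin (suc n) → ℚ
  profile v c = excessIf (condition c) (0ℚ <? x (condition c)) v

  ∑-profile≡0 : ∀ u → RI u → ∀ c → ∑ r (λ l → profile (u l) c) ≡ 0ℚ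
  ∑-profile≡0 u Iu c with 0ℚ <? x (condition c)
  ... | yes 0<x = ∑-excess≡0 (condition c) (condition-extendable c) 0<x u Iu
  ... | no _    = ∑-zero r

  profile-nonzero : ∀ v → ∃ λ c → ¬ profile v c ≡ 0ℚ
  profile-nonzero v with 0ℚ <? x ⟨ v ↦𝟙⟩
  ... | yes 0<p = suc v , λ eq → <-irrefl (trans (sym eq) profile≡) 0<[r-s]p
    where
    p : ℚ
    p = x ⟨ v ↦𝟙⟩
    profile≡ : profile v (suc v) ≡ (fromℕ r - fromℕ s) * p
    profile≡ = begin
      profile v (suc v)
        ≡⟨ excessIf-pos ⟨ v ↦𝟙⟩ v (0ℚ <? p) 0<p ⟩
      fromℕ r * xExt x ⟨ v ↦𝟙⟩ v 𝟙 - fromℕ s * p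
        ≡⟨ cong (λ t → fromℕ r * t - fromℕ s * p) (xExt-assigned x ⟨ v ↦𝟙⟩ v 𝟙 (lookup∘update v ∅ (just 𝟙))) ⟩
      fromℕ r * p - fromℕ s * p
        ≡⟨ solve 3 (λ a c d → a :* d :- c :* d := (a :- c) :* d) refl (fromℕ r) (fromℕ s) p ⟩
      (fromℕ r - fromℕ s) * p ∎
      where open ≡-Reasoning
    0<[r-s]p : 0ℚ <ℚ (fromℕ r - fromℕ s) * p
    0<[r-s]p = positive⁻¹ _ {{pos*pos⇒pos (fromℕ r - fromℕ s) {{positive 0<r-s}} p {{positive 0<p}}}}
  ... | no ¬0<p = zero , λ eq → <-irrefl (sym (neg-injective (trans (sym profile≡) eq))) 0<s
    where
    p≡0 : x ⟨ v ↦𝟙⟩ ≡ 0ℚ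
    p≡0 = ≤-antisym (≮⇒≥ ¬0<p) (x≥0 ⟨ v ↦𝟙⟩ (subst (_≤ℕ 2) (sym (size-⟨↦𝟙⟩ v)) (s≤ z≤)))
    profile≡ : profile v zero ≡ - fromℕ s
    profile≡ = begin
      profile v zero
        ≡⟨ excessIf-pos ∅ v (0ℚ <? x ∅) 0<x∅ ⟩
      fromℕ r * xExt x ∅ v 𝟙 - fromℕ s * x ∅
        ≡⟨ cong₂ (λ t e → fromℕ r * t - fromℕ s * e)
             (trans (xExt-unassigned x ∅ v 𝟙 (lookup-replicate v nothing)) p≡0) x∅≡1 ⟩
      fromℕ r * 0ℚ - fromℕ s * 1ℚ
        ≡⟨ solve 2 (λ a c → a :* con 0ℚ :- c :* con 1ℚ := :- c) refl (fromℕ r) (fromℕ s) ⟩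
      - fromℕ s ∎
      where open ≡-Reasoning

  assignment : Fin n → Fin 2
  assignment v = if lexPositive (profile v) then 𝟙 else 𝟘

  -- The position l₀ only witnesses r > 0.
  assignment-NAE : Fin r → ∀ u → RI u → NAE r (assignment ∘ u)
  assignment-NAE l₀ u Iu with profile-nonzero (u l₀)
  ... | c , nonzero with lexPositive-split r (suc n) (profile ∘ u) (∑-profile≡0 u Iu) l₀ c nonzero
  ...   | (l⁺ , pos) , (l⁻ , neg) =
    (λ all𝟘 → 𝟙≢𝟘 (trans (sym (cong toFin2 pos)) (all𝟘 l⁺))) ,
    (λ all𝟙 → 𝟙≢𝟘 (trans (sym (all𝟙 l⁻)) (cong toFin2 neg)))
    where
    toFin2 : Bool → Fin 2
    toFin2 β = if β then 𝟙 else 𝟘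
    𝟙≢𝟘 : ¬ 𝟙 ≡ 𝟘
    𝟙≢𝟘 ()

lemma4p4 : (s r : ℕ) → 0 < s → s < r →
    (n : ℕ) → (RI : (Fin r → Fin n) → Set) →
    (m : ℕ) → (A : Fin m → Row r) → (b : Fin m → ℚ) → Describes s r m A b →
    SAFeasible 2 s r n m RI A b → HomToNAE n r RI
lemma4p4 (suc s) (suc r) _ s<r n RI m A b desc (x , x∅≡1 , _ , Ax≤bx , x∈[0,1]) =
  assignment , assignment-NAE zero
  where
  open NAEFromSA {RI = RI} {A} {b} desc x x∅≡1 Ax≤bx (λ f small → proj₁ (x∈[0,1] f small))
    (0<fromℕ-suc s) (fromℕ-<⇒0<- s<r)
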